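{- Let $N,b\geq1$ be integers, and for each $n\geq1$ let $m_n\geq1$ and $k_{j,l,n}\in\mathbb{Z}$ ($1\leq j\leq N$, $1\leq l\leq b$) be given. Then there exist a strictly increasing map $\psi:\mathbb{N}\to\mathbb{N}$ and, for each $l\in\{1,\dots,b\}$, a set $J_l\subset\{1,\dots,N\}$ such that: (a) for each $l$ with $J_l\neq\emptyset$, the sequence $\big((\zeta_{m_{\psi(n)}}^{k_{j,l,\psi(n)}})_{j\in J_l}\big)_n$ in $(\overline{\mathbb{Q}}^*)^{\#J_l}$ is strict; (b) for every $l\in\{1,\dots,b\}$ and every $j\in\{1,\dots,N\}$ there exist an integer $\lambda^{(j,l)}\in\mathbb{Z}\setminus\{0\}$ and a tuple $(\lambda_m^{(j,l)})_{m\in J_l}\in\mathbb{Z}^{\#J_l}$ such that for all $n$, $$\lambda^{(j,l)}k_{j,l,\psi(n)}+\sum_{m\in J_l}\lambda_m^{(j,l)}k_{m,l,\psi(n)}\equiv0\pmod{m_{\psi(n)}}.$$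
   Context: $\zeta_m=e^{2i\pi/m}$. A sequence $(P_n)$ in $(\overline{\mathbb{Q}}^*)^M$ is strict if every proper algebraic subgroup of $(\overline{\mathbb{Q}}^*)^M$ contains $P_n$ for only finitely many $n$. An empty sum is $0$. (In the paper these data come from writing elements $x_n$ of $\mathbb{Q}(\Gamma_{\mathrm{div}})$ as $x_n=\sum_{j=1}^Nx_{j,n}\prod_{l=1}^b\alpha_l^{k_{j,l,n}/m_n}$, and $(x_{\psi(n)})$ is the corresponding subsequence.) -}

module Defs where

open import Data.Nat using (ℕ; zero; suc; _≤_)
open import Data.Integer using (ℤ; +_; _+_; _*_)
open import Data.Integer.Divisibility using (_∣_)
open import Data.Fin using (Fin; zero; suc)
open import Data.List using (List)
open import Data.List.Relation.Unary.All using (All)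
open import Data.List.Relation.Unary.Any using (Any)
open import Data.Product using (∃)
open import Relation.Nullary using (¬_)
open import Relation.Binary.PropositionalEquality using (_≢_)

Σ' : ∀ n → (Fin n → ℤ) → ℤ
Σ' zero    f = + 0
Σ' (suc n) f = f zero + Σ' n (λ i → f (suc i))

-- The torsion point (ζ_m^{e_1}, ..., ζ_m^{e_M}) of (Qbar^*)^M, ζ_m = e^{2iπ/m}.
record TorsionPoint (M : ℕ) : Set where
  constructor tp
  field
    order : ℕ
    exps  : Fin M → ℤ

-- A character x ↦ x^χ = ∏ x_j^{χ_j} of (Qbar^*)^M.
Character : ℕ → Set
Character M = Fin M → ℤ

-- x^χ = 1 at x = (ζ_m^{e_j})_j  ⇔  ζ_m^{Σ χ_j e_j} = 1  ⇔  m ∣ Σ χ_j e_j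
CharTrivialAt : ∀ {M} → Character M → TorsionPoint M → Set
CharTrivialAt {M} χ (tp m e) = (+ m) ∣ Σ' M (λ j → χ j * e j)

-- Algebraic subgroups of (Qbar^*)^M: H_Λ = {x | x^χ = 1 for all χ ∈ Λ},
-- Λ given by a finite list of generators of the character lattice.
AlgSubgroup : ℕ → Set
AlgSubgroup M = List (Character M)

_∈H_ : ∀ {M} → TorsionPoint M → AlgSubgroup M → Set
P ∈H Λ = All (λ χ → CharTrivialAt χ P) Λ

-- H_Λ is proper iff Λ ≠ 0, i.e. some generator is a nonzero character.
Proper : ∀ {M} → AlgSubgroup M → Set
Proper Λ = Any (λ χ → ∃ λ j → χ j ≢ + 0) Λ

Strict : ∀ M → (ℕ → TorsionPoint M) → Set
Strict M P = ∀ (Λ : AlgSubgroup M) → Proper Λ →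
  ∃ λ B → ∀ n → B ≤ n → ¬ (P n ∈H Λ)

{-# OPTIONS --safe #-}
-- Fix l and start from all N coordinates of the points (ζ_{m_n}^{k_{j,l,n}})_j.  If the
-- points restricted to the current coordinates do not form a strict sequence, then some
-- nonzero character χ is trivial at infinitely many of them: pass to that subsequence and
-- drop a coordinate i with χ_i ≠ 0, after cancelling the i-th coefficient of every relation
-- found so far against χ.  Every relation keeps a nonzero coefficient at j, and the process
-- stops after at most N steps.  Strictness and relations both survive passing to a further
-- subsequence, so the b indices l can be treated one after another.
module Submission where

open import Defs
open import Level using (0ℓ)
open import Axiom.ExcludedMiddle using (ExcludedMiddle)
open import Axiom.DoubleNegationElimination using (DoubleNegationElimination; em⇒dne)
open import Data.Nat using (ℕ; zero; suc; z≤n; _≤_; _<_)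
open import Data.Nat.Properties using (≤-trans; ≤-<-trans; <-trans; n<1+n; m<1+n⇒m<n∨m≡n)
open import Data.Nat.Divisibility using (_∣0)
open import Data.Integer using (ℤ; +_; -1ℤ; _+_; _*_; -_)
open import Data.Integer.Properties
  using (+-*-semiring; +-identityˡ; +-identityʳ; +-inverseˡ; *-identityˡ; -1*i≡-i; i*j≡0⇒i≡0∨j≡0)
open import Data.Integer.Divisibility using (_∣_)
import Data.Integer.Divisibility.Signed as Signed
open import Data.Integer.Tactic.RingSolver using (solve-∀)
open import Algebra.Properties.Semiring.Sum +-*-semiring
  using (sum; sum-cong-≗; sum-remove; ∑-distrib-+; *-distribˡ-sum)
open import Data.Fin using (Fin; zero; suc)
open import Data.Fin.Properties using (punchIn-injective)
open import Data.Vec.Functional using (_∷_; removeAt)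
open import Data.List.Relation.Unary.All using (lookupAny)
import Data.List.Relation.Unary.Any as Any
open import Data.List.Relation.Unary.Any.Properties using (lookup-result)
open import Data.Product using (Σ; ∃; _×_; _,_; proj₁; proj₂)
open import Data.Sum using (inj₁; inj₂; [_,_])
open import Function using (id; _∘_)
open import Function.Definitions using (Injective)
open import Relation.Nullary using (¬_; yes; no; contradiction)
open import Relation.Binary.PropositionalEquality
  using (_≡_; _≢_; refl; sym; trans; cong; cong₂; subst; module ≡-Reasoning)

private
  variable
    M s : ℕ

StrictlyIncreasing : (ℕ → ℕ) → Set
StrictlyIncreasing ψ = ∀ n n′ → n < n′ → ψ n < ψ n′

id-strictlyIncreasing : StrictlyIncreasing id
id-strictlyIncreasing _ _ n<n′ = n<n′

∘-strictlyIncreasing : ∀ {ψ φ} → StrictlyIncreasing ψ → StrictlyIncreasing φ →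
                       StrictlyIncreasing (ψ ∘ φ)
∘-strictlyIncreasing ψ↑ φ↑ n n′ n<n′ = ψ↑ _ _ (φ↑ n n′ n<n′)

stepwise⇒strictlyIncreasing : ∀ {φ} → (∀ n → φ n < φ (suc n)) → StrictlyIncreasing φ
stepwise⇒strictlyIncreasing step n (suc n′) n<1+n′ with m<1+n⇒m<n∨m≡n n<1+n′
... | inj₁ n<n′ = <-trans (stepwise⇒strictlyIncreasing step n n′ n<n′) (step n′)
... | inj₂ refl = step n

strictlyIncreasing⇒inflationary : ∀ {φ} → StrictlyIncreasing φ → ∀ n → n ≤ φ n
strictlyIncreasing⇒inflationary φ↑ zero    = z≤n
strictlyIncreasing⇒inflationary φ↑ (suc n) =
  ≤-<-trans (strictlyIncreasing⇒inflationary φ↑ n) (φ↑ n (suc n) (n<1+n n))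

InfinitelyOften : (ℕ → Set) → Set
InfinitelyOften Q = ∀ B → ∃ λ n → B ≤ n × Q n

infinitelyOften⇒subsequence : ∀ {Q} → InfinitelyOften Q →
  Σ (ℕ → ℕ) λ φ → StrictlyIncreasing φ × (∀ n → Q (φ n))
infinitelyOften⇒subsequence {Q} often =
  φ , stepwise⇒strictlyIncreasing (λ n → proj₁ (proj₂ (often (suc (φ n))))) , Qφ
  where
  φ : ℕ → ℕ
  φ zero    = proj₁ (often 0)
  φ (suc n) = proj₁ (often (suc (φ n)))

  Qφ : ∀ n → Q (φ n)
  Qφ zero    = proj₂ (proj₂ (often 0))
  Qφ (suc n) = proj₂ (proj₂ (often (suc (φ n))))

Strict-∘ : ∀ {P φ} → StrictlyIncreasing φ → Strict M P → Strict M (P ∘ φ)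
Strict-∘ {φ = φ} φ↑ strict Λ proper =
  let B , outside = strict Λ proper
  in  B , λ n B≤n → outside (φ n) (≤-trans B≤n (strictlyIncreasing⇒inflationary φ↑ n))

¬strict⇒frequentCharacter : DoubleNegationElimination 0ℓ → ∀ {P} → ¬ Strict M P →
  Σ (Character M) λ χ → (∃ λ i → χ i ≢ + 0) × InfinitelyOften (λ n → CharTrivialAt χ (P n))
¬strict⇒frequentCharacter {M} dne {P} ¬strict =
  let Λ , proper , often = frequentSubgroup
  in  Any.lookup proper , lookup-result proper ,
      λ B → let n , B≤n , Pn∈Λ = often B in n , B≤n , proj₁ (lookupAny Pn∈Λ proper)
  where
  frequentSubgroup : Σ (AlgSubgroup M) λ Λ → Proper Λ × InfinitelyOften (λ n → P n ∈H Λ)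
  frequentSubgroup = dne λ ¬frequent → ¬strict λ Λ proper →
    dne λ ¬eventuallyOutside → ¬frequent (Λ , proper , λ B →
      dne λ ¬after → ¬eventuallyOutside (B , λ n B≤n Pn∈Λ → ¬after (n , B≤n , Pn∈Λ)))

Σ'≡sum : ∀ n (f : Fin n → ℤ) → Σ' n f ≡ sum f
Σ'≡sum zero    f = refl
Σ'≡sum (suc n) f = cong (_+_ (f zero)) (Σ'≡sum n (f ∘ suc))

Σ'-combination : ∀ n a b (f g : Fin n → ℤ) →
                 Σ' n (λ i → a * f i + b * g i) ≡ a * Σ' n f + b * Σ' n g
Σ'-combination n a b f g = begin
  Σ' n (λ i → a * f i + b * g i)            ≡⟨ Σ'≡sum n _ ⟩
  sum (λ i → a * f i + b * g i)             ≡⟨ ∑-distrib-+ (λ i → a * f i) (λ i → b * g i) ⟩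
  sum (λ i → a * f i) + sum (λ i → b * g i) ≡⟨ cong₂ _+_ (*-distribˡ-sum a f) (*-distribˡ-sum b g) ⟨
  a * sum f + b * sum g                     ≡⟨ cong₂ (λ x y → a * x + b * y) (Σ'≡sum n f) (Σ'≡sum n g) ⟨
  a * Σ' n f + b * Σ' n g                   ∎
  where open ≡-Reasoning

∣-combination : ∀ {d x y} a b → d ∣ x → d ∣ y → d ∣ a * x + b * y
∣-combination {d} {x} {y} a b d∣x d∣y = Signed.∣⇒∣ᵤ {d} {a * x + b * y}
  (Signed.∣m∣n⇒∣m+n (Signed.∣n⇒∣m*n a (Signed.∣ᵤ⇒∣ {d} {x} d∣x))
                    (Signed.∣n⇒∣m*n b (Signed.∣ᵤ⇒∣ {d} {y} d∣y)))

restrict : (Fin s → Fin M) → TorsionPoint M → TorsionPoint s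
restrict ι P = tp (TorsionPoint.order P) (TorsionPoint.exps P ∘ ι)

trivialAt-combination : ∀ a b {χ ξ : Character M} P → CharTrivialAt χ P → CharTrivialAt ξ P →
                        CharTrivialAt (λ i → a * χ i + b * ξ i) P
trivialAt-combination {M} a b {χ} {ξ} (tp m e) χ∣ ξ∣ =
  subst (+ m ∣_) (sym sum-expansion) (∣-combination {+ m} a b χ∣ ξ∣)
  where
  distrib : ∀ a b x y z → (a * x + b * y) * z ≡ a * (x * z) + b * (y * z)
  distrib = solve-∀

  sum-expansion : Σ' M (λ i → (a * χ i + b * ξ i) * e i)
                ≡ a * Σ' M (λ i → χ i * e i) + b * Σ' M (λ i → ξ i * e i)
  sum-expansion = begin
    Σ' M (λ i → (a * χ i + b * ξ i) * e i)               ≡⟨ Σ'≡sum M _ ⟩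
    sum (λ i → (a * χ i + b * ξ i) * e i)                ≡⟨ sum-cong-≗ (λ i → distrib a b (χ i) (ξ i) (e i)) ⟩
    sum (λ i → a * (χ i * e i) + b * (ξ i * e i))        ≡⟨ Σ'≡sum M _ ⟨
    Σ' M (λ i → a * (χ i * e i) + b * (ξ i * e i))       ≡⟨ Σ'-combination M a b _ _ ⟩
    a * Σ' M (λ i → χ i * e i) + b * Σ' M (λ i → ξ i * e i) ∎
    where open ≡-Reasoning

trivialAt-∷-zero : ∀ {ξ : Character s} {ι : Fin s → Fin M} j P →
                   CharTrivialAt ξ (restrict ι P) → CharTrivialAt (+ 0 ∷ ξ) (restrict (j ∷ ι) P)
trivialAt-∷-zero {s} {ξ = ξ} {ι} j (tp m e) ξ∣ =
  subst (+ m ∣_) (sym (+-identityˡ (Σ' s (λ t → ξ t * e (ι t))))) ξ∣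

trivialAt-removeAt : ∀ {χ : Character (suc s)} {ι : Fin (suc s) → Fin M} i P → χ i ≡ + 0 →
                     CharTrivialAt χ (restrict ι P) →
                     CharTrivialAt (removeAt χ i) (restrict (removeAt ι i) P)
trivialAt-removeAt {s} {χ = χ} {ι} i (tp m e) χᵢ≡0 χ∣ = subst (+ m ∣_) sum-removal χ∣
  where
  f : Fin (suc s) → ℤ
  f t = χ t * e (ι t)

  sum-removal : Σ' (suc s) f ≡ Σ' s (removeAt f i)
  sum-removal = begin
    Σ' (suc s) f                ≡⟨ Σ'≡sum (suc s) f ⟩
    sum f                       ≡⟨ sum-remove f ⟩
    f i + sum (removeAt f i)    ≡⟨ cong (λ c → c * e (ι i) + sum (removeAt f i)) χᵢ≡0 ⟩
    + 0 + sum (removeAt f i)    ≡⟨ +-identityˡ _ ⟩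
    sum (removeAt f i)          ≡⟨ Σ'≡sum s _ ⟨
    Σ' s (removeAt f i)         ∎
    where open ≡-Reasoning

Σ'-zero : ∀ s → Σ' s (λ _ → + 0) ≡ + 0
Σ'-zero zero    = refl
Σ'-zero (suc s) = trans (+-identityˡ _) (Σ'-zero s)

unit : Fin s → Character s
unit zero    zero    = + 1
unit zero    (suc _) = + 0
unit (suc _) zero    = + 0
unit (suc i) (suc t) = unit i t

Σ'-unit : ∀ (i : Fin s) (f : Fin s → ℤ) → Σ' s (λ t → unit i t * f t) ≡ f i
Σ'-unit {suc s} zero    f =
  trans (cong₂ _+_ (*-identityˡ (f zero)) (Σ'-zero s)) (+-identityʳ (f zero))
Σ'-unit {suc s} (suc i) f = trans (+-identityˡ _) (Σ'-unit i (f ∘ suc))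

-- χ is indexed by j followed by the coordinates ι: in the paper's notation χ zero = λ^{(j,l)}
-- and χ (suc i) = λ^{(j,l)}_{ι i}.
record Dependent (P : ℕ → TorsionPoint M) (ι : Fin s → Fin M) (j : Fin M) : Set where
  constructor dependent
  field
    relation    : Character (suc s)
    relation₀≢0 : relation zero ≢ + 0
    trivial     : ∀ n → CharTrivialAt relation (restrict (j ∷ ι) (P n))

Dependent-∘ : ∀ {P} {ι : Fin s → Fin M} {j} φ → Dependent P ι j → Dependent (P ∘ φ) ι j
Dependent-∘ φ (dependent χ χ₀≢0 χ∣) = dependent χ χ₀≢0 (χ∣ ∘ φ)

Dependent-selected : ∀ P (ι : Fin s → Fin M) i → Dependent P ι (ι i)
Dependent-selected {s} P ι i = dependent (-1ℤ ∷ unit i) (λ ()) λ n →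
  subst (+ order (P n) ∣_) (sym (relation (exps (P n) ∘ ι))) (order (P n) ∣0)
  where
  open TorsionPoint
  relation : ∀ e → -1ℤ * e i + Σ' s (λ t → unit i t * e t) ≡ + 0
  relation e = begin
    -1ℤ * e i + Σ' s (λ t → unit i t * e t) ≡⟨ cong₂ _+_ (-1*i≡-i (e i)) (Σ'-unit i e) ⟩
    - e i + e i                             ≡⟨ +-inverseˡ (e i) ⟩
    + 0                                     ∎
    where open ≡-Reasoning

Dependent-removeAt : ∀ {P} {ι : Fin (suc s) → Fin M} {j} (ξ : Character (suc s)) i → ξ i ≢ + 0 →
                     (∀ n → CharTrivialAt ξ (restrict ι (P n))) →
                     Dependent P ι j → Dependent P (removeAt ι i) j
Dependent-removeAt {P = P} {ι} {j} ξ i ξᵢ≢0 ξ∣ (dependent χ χ₀≢0 χ∣) =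
  dependent (removeAt χ′ (suc i)) χ′₀≢0 λ n →
    trivialAt-removeAt {χ = χ′} {j ∷ ι} (suc i) (P n) χ′ᵢ≡0 (χ′∣ n)
  where
  χ′ : Character _
  χ′ t = ξ i * χ t + (- χ (suc i)) * (+ 0 ∷ ξ) t

  χ′∣ : ∀ n → CharTrivialAt χ′ (restrict (j ∷ ι) (P n))
  χ′∣ n = trivialAt-combination (ξ i) (- χ (suc i)) {χ} {+ 0 ∷ ξ} (restrict (j ∷ ι) (P n))
            (χ∣ n) (trivialAt-∷-zero {ξ = ξ} {ι} j (P n) (ξ∣ n))

  χ′ᵢ≡0 : χ′ (suc i) ≡ + 0
  χ′ᵢ≡0 = cancel (ξ i) (χ (suc i))
    where
    cancel : ∀ a c → a * c + (- c) * a ≡ + 0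
    cancel = solve-∀

  χ′₀≢0 : χ′ zero ≢ + 0
  χ′₀≢0 χ′₀≡0 = [ ξᵢ≢0 , χ₀≢0 ]
    (i*j≡0⇒i≡0∨j≡0 (ξ i) (trans (sym (drop (ξ i * χ zero) (- χ (suc i)))) χ′₀≡0))
    where
    drop : ∀ x c → x + c * + 0 ≡ x
    drop = solve-∀

record StrictSelection (P : ℕ → TorsionPoint M) : Set where
  field
    size      : ℕ
    coords    : Fin size → Fin M
    injective : Injective _≡_ _≡_ coords
    strict    : size ≢ 0 → Strict size (restrict coords ∘ P)
    relations : ∀ j → Dependent P coords j

StrictSelection-∘ : ∀ {P φ} → StrictlyIncreasing φ → StrictSelection {M} P → StrictSelection (P ∘ φ)
StrictSelection-∘ {φ = φ} φ↑ selection = record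
  { size      = size
  ; coords    = coords
  ; injective = injective
  ; strict    = λ size≢0 → Strict-∘ φ↑ (strict size≢0)
  ; relations = λ j → Dependent-∘ φ (relations j)
  }
  where open StrictSelection selection

module _ (em : ExcludedMiddle 0ℓ) where

  refineSelection : ∀ s P (ι : Fin s → Fin M) → Injective _≡_ _≡_ ι → (∀ j → Dependent P ι j) →
                    Σ (ℕ → ℕ) λ φ → StrictlyIncreasing φ × StrictSelection (P ∘ φ)
  refineSelection zero P ι ι-inj dep =
    id , id-strictlyIncreasing , record
      { size = 0 ; coords = ι ; injective = ι-inj
      ; strict = λ 0≢0 → contradiction refl 0≢0 ; relations = dep }
  refineSelection (suc s) P ι ι-inj dep with em {Strict (suc s) (restrict ι ∘ P)}
  ... | yes strict = id , id-strictlyIncreasing , record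
      { size = suc s ; coords = ι ; injective = ι-inj ; strict = λ _ → strict ; relations = dep }
  ... | no ¬strict =
    let ξ , (i , ξᵢ≢0) , often = ¬strict⇒frequentCharacter (em⇒dne em) {restrict ι ∘ P} ¬strict
        φ , φ↑ , ξ∣ = infinitelyOften⇒subsequence often
        φ′ , φ′↑ , selection = refineSelection s (P ∘ φ) (removeAt ι i)
          (λ eq → punchIn-injective i _ _ (ι-inj eq))
          (λ j → Dependent-removeAt ξ i ξᵢ≢0 ξ∣ (Dependent-∘ φ (dep j)))
    in  φ ∘ φ′ , ∘-strictlyIncreasing φ↑ φ′↑ , selection

  strictSelection : ∀ (P : ℕ → TorsionPoint M) →
                    Σ (ℕ → ℕ) λ φ → StrictlyIncreasing φ × StrictSelection (P ∘ φ)
  strictSelection {M} P = refineSelection M P id id (Dependent-selected P id)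

simultaneousSubsequence : ∀ {b} (R : Fin b → (ℕ → ℕ) → Set) →
  (∀ l {ψ φ} → StrictlyIncreasing φ → R l ψ → R l (ψ ∘ φ)) →
  (∀ l ψ → Σ (ℕ → ℕ) λ φ → StrictlyIncreasing φ × R l (ψ ∘ φ)) →
  Σ (ℕ → ℕ) λ ψ → StrictlyIncreasing ψ × ∀ l → R l ψ
simultaneousSubsequence {zero}  R stable refine = id , id-strictlyIncreasing , λ ()
simultaneousSubsequence {suc b} R stable refine =
  let ψ , ψ↑ , Rψ = simultaneousSubsequence (R ∘ suc) (λ l → stable (suc l)) (refine ∘ suc)
      φ , φ↑ , R₀ = refine zero ψ
  in  ψ ∘ φ , ∘-strictlyIncreasing ψ↑ φ↑ , λ { zero → R₀ ; (suc l) → stable (suc l) φ↑ (Rψ l) }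

lemma7p1 : ExcludedMiddle 0ℓ →
    (N b : ℕ) → 1 ≤ N → 1 ≤ b →
    (m : ℕ → ℕ) → (∀ n → 1 ≤ m n) →
    (k : Fin N → Fin b → ℕ → ℤ) →
    Σ (ℕ → ℕ) λ ψ → (∀ n n′ → n < n′ → ψ n < ψ n′) ×
    Σ (Fin b → ℕ) λ s → Σ ((l : Fin b) → Fin (s l) → Fin N) λ ι →
      (∀ l → Injective _≡_ _≡_ (ι l)) ×
      (∀ l → s l ≢ 0 →
        Strict (s l) (λ n → tp (m (ψ n)) (λ i → k (ι l i) l (ψ n)))) ×
      (∀ (l : Fin b) (j : Fin N) →
        Σ ℤ λ c → (c ≢ + 0) × Σ (Fin (s l) → ℤ) λ μ →
          ∀ n → (+ m (ψ n)) ∣ (c * k j l (ψ n) + Σ' (s l) (λ i → μ i * k (ι l i) l (ψ n))))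
lemma7p1 em N b _ _ m _ k =
  let ψ , ψ↑ , selection = simultaneousSubsequence (λ l ψ → StrictSelection (column l ∘ ψ))
                             (λ l → StrictSelection-∘) (λ l ψ → strictSelection em (column l ∘ ψ))
  in  ψ , ψ↑ , (λ l → size (selection l)) , (λ l → coords (selection l)) ,
      (λ l → injective (selection l)) , (λ l → strict (selection l)) ,
      λ l j → let dependent χ χ₀≢0 χ∣ = relations (selection l) j
              in  χ zero , χ₀≢0 , χ ∘ suc , χ∣
  where
  open StrictSelection
  column : Fin b → ℕ → TorsionPoint N
  column l n = tp (m n) (λ j → k j l n)
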